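{- Let $1 \le k \le n$ and let $u = (1,\dots,1,0,\dots,0) \in \{0,1\}^n$ with $\|u\| = k$. Let $T_{n,k,2} = \{ v \in \{0,1\}^n : \|v - 0_n\| \le k \text{ and } \|v - u\| \le k\}$. Then for every $B \in \mathcal{B}_{n,k}$ there exists an isometry $g$ of $\{0,1\}^n$ (with respect to the Hamming metric) such that $g \cdot B \subseteq T_{n,k,2}$.
   Context: $\|w\| = \sum_i |w_i|$ and $\|u-v\|$ is the Hamming distance. $\mathcal{B}_{n,k}$ is the family of all sets $B \subseteq \{0,1\}^n$ such that $\|u-v\|\le k$ for all $u,v\in B$, and $B$ is maximal with this property: for every $w \in \{0,1\}^n\setminus B$, the set $B\cup\{w\}$ has Hamming diameter $>k$. The isometry group of $\{0,1\}^n$ has order $2^n n!$ (coordinate permutations composed with translations by XOR). -}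

module Defs where

open import Data.Nat using (ℕ; zero; suc; _+_; _≤_; _>_)
open import Data.Bool using (Bool; true; false; _xor_; _∨_; T)
open import Data.Vec using (Vec; []; _∷_; zipWith; replicate; _++_)
open import Data.Vec.Properties using (≡-dec)
open import Data.Bool.Properties using () renaming (_≟_ to _≟B_)
open import Data.Product using (_×_; ∃)
open import Data.Empty using (⊥)
open import Relation.Nullary using (¬_)
open import Relation.Nullary.Decidable using (⌊_⌋)
open import Relation.Binary.PropositionalEquality using (_≡_)

-- points of the hypercube {0,1}^n (true = 1)
Word : ℕ → Set
Word n = Vec Bool n

weight : ∀ {n} → Word n → ℕ
weight [] = 0
weight (true ∷ w) = suc (weight w)
weight (false ∷ w) = weight w

-- Hamming distance ‖u - v‖ (u - v = u XOR v over F_2)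
dist : ∀ {n} → Word n → Word n → ℕ
dist u v = weight (zipWith _xor_ u v)

Subset : ℕ → Set
Subset n = Word n → Bool

_∈_ : ∀ {n} → Word n → Subset n → Set
w ∈ B = T (B w)

insert : ∀ {n} → Word n → Subset n → Subset n
insert w B v = ⌊ ≡-dec _≟B_ v w ⌋ ∨ B v

DiamLe : ∀ {n} → ℕ → Subset n → Set
DiamLe k B = ∀ u v → u ∈ B → v ∈ B → dist u v ≤ k

DiamGt : ∀ {n} → ℕ → Subset n → Set
DiamGt k B = ∃ λ u → ∃ λ v → (u ∈ B) × (v ∈ B) × (dist u v > k)

InB : (n k : ℕ) → Subset n → Set
InB n k B = DiamLe k B × (∀ w → ¬ (w ∈ B) → DiamGt k (insert w B))

IsIsometry : ∀ {n} → (Word n → Word n) → Set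
IsIsometry {n} g = ∀ u v → dist (g u) (g v) ≡ dist u v

-- u = (1,…,1,0,…,0) with k ones, for k ≤ n (written with n = k + m)
uVec : (k m : ℕ) → Word (k + m)
uVec k m = replicate k true ++ replicate m false

T₂ : (k m : ℕ) → Word (k + m) → Set
T₂ k m v = dist v (replicate (k + m) false) ≤ k × dist v (uVec k m) ≤ k

-- Maximality forces the diameter of B to be attained: starting from b, b ∈ B, keep moving
-- the second point one step away from the first while staying in B; once the step leaves
-- B, maximality gives a point of B at distance > k from the new point, hence at distance
-- exactly k from the old one. For p, q ∈ B with dist p q = k, translating by p and then
-- moving the support of p ⊕ q to the front is an isometry sending p to 0 and q to u, and
-- every point of B, being within k of p and q, is sent within k of 0 and u.
module Submission where

open import Defs
open import Data.Nat using (ℕ; zero; suc; _+_; _≤_; _<_; z≤n; s≤s; s≤s⁻¹)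
open import Data.Nat.Properties
open import Data.Bool using (true; false; _xor_)
open import Data.Bool.Properties using (xor-comm; xor-same; T?) renaming (_≟_ to _≟B_)
open import Data.Vec using (Vec; []; _∷_; zipWith; replicate)
open import Data.Vec.Properties using (≡-dec; zipWith-comm)
open import Data.Product using (_×_; ∃; _,_; proj₁; proj₂)
open import Data.Empty using (⊥-elim)
open import Function using (_∘_)
open import Relation.Nullary using (¬_; Dec; yes; no)
open import Relation.Binary.PropositionalEquality

private
  variable
    n : ℕ
    A : Set

infixl 6 _⊕_

_⊕_ : Word n → Word n → Word n
_⊕_ = zipWith _xor_

⊕-self : (u : Word n) → u ⊕ u ≡ replicate n false
⊕-self []      = refl
⊕-self (a ∷ u) = cong₂ _∷_ (xor-same a) (⊕-self u)

⊕-cancelˡ : (p u v : Word n) → (p ⊕ u) ⊕ (p ⊕ v) ≡ u ⊕ v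
⊕-cancelˡ []      []      []      = refl
⊕-cancelˡ (a ∷ p) (b ∷ u) (c ∷ v) = cong₂ _∷_ (xor-cancelˡ a b c) (⊕-cancelˡ p u v)
  where
  xor-cancelˡ : ∀ a b c → (a xor b) xor (a xor c) ≡ b xor c
  xor-cancelˡ false b     c     = refl
  xor-cancelˡ true  false false = refl
  xor-cancelˡ true  false true  = refl
  xor-cancelˡ true  true  false = refl
  xor-cancelˡ true  true  true  = refl

weight-zeros : ∀ n → weight (replicate n false) ≡ 0
weight-zeros zero    = refl
weight-zeros (suc n) = weight-zeros n

weight≤length : (w : Word n) → weight w ≤ n
weight≤length []          = z≤n
weight≤length (true ∷ w)  = s≤s (weight≤length w)
weight≤length (false ∷ w) = m≤n⇒m≤1+n (weight≤length w)

weight-⊕-≤ : (u v : Word n) → weight (u ⊕ v) ≤ weight u + weight v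
weight-⊕-≤ []          []          = z≤n
weight-⊕-≤ (true ∷ u)  (true ∷ v)  =
  ≤-trans (weight-⊕-≤ u v) (m≤n⇒m≤1+n (+-monoʳ-≤ (weight u) (n≤1+n (weight v))))
weight-⊕-≤ (true ∷ u)  (false ∷ v) = s≤s (weight-⊕-≤ u v)
weight-⊕-≤ (false ∷ u) (true ∷ v)  =
  ≤-trans (s≤s (weight-⊕-≤ u v)) (≤-reflexive (sym (+-suc (weight u) (weight v))))
weight-⊕-≤ (false ∷ u) (false ∷ v) = weight-⊕-≤ u v

dist-self : (u : Word n) → dist u u ≡ 0
dist-self {n} u = trans (cong weight (⊕-self u)) (weight-zeros n)

dist-sym : (u v : Word n) → dist u v ≡ dist v u
dist-sym u v = cong weight (zipWith-comm xor-comm u v)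

dist-triangle : (u v w : Word n) → dist u w ≤ dist u v + dist v w
dist-triangle u v w = begin
  dist u w                    ≡⟨ cong weight (⊕-cancelˡ v u w) ⟨
  weight ((v ⊕ u) ⊕ (v ⊕ w))  ≤⟨ weight-⊕-≤ (v ⊕ u) (v ⊕ w) ⟩
  dist v u + dist v w         ≡⟨ cong (_+ dist v w) (dist-sym v u) ⟩
  dist u v + dist v w         ∎
  where open ≤-Reasoning

dist≥-neighbour : ∀ {k} (u v w : Word n) → dist u v ≡ 1 → k < dist u w → k ≤ dist v w
dist≥-neighbour u v w uv≡1 k<uw =
  s≤s⁻¹ (≤-trans k<uw (subst (λ d → dist u w ≤ d + dist v w) uv≡1 (dist-triangle u v w)))

isometry-∘ : {g h : Word n → Word n} → IsIsometry g → IsIsometry h → IsIsometry (g ∘ h)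
isometry-∘ {g = g} {h} g-iso h-iso u v = trans (g-iso (h u) (h v)) (h-iso u v)

isometry-translate : (p : Word n) → IsIsometry (p ⊕_)
isometry-translate p u v = cong weight (⊕-cancelˡ p u v)

insertAfter : ℕ → A → Vec A n → Vec A (suc n)
insertAfter zero    a v       = a ∷ v
insertAfter (suc j) a []      = a ∷ []
insertAfter (suc j) a (b ∷ v) = b ∷ insertAfter j a v

-- The stable permutation of coordinates putting those in the support of w first.
supportFirst : Word n → Vec A n → Vec A n
supportFirst []          []      = []
supportFirst (true ∷ w)  (a ∷ v) = a ∷ supportFirst w v
supportFirst (false ∷ w) (a ∷ v) = insertAfter (weight w) a (supportFirst w v)

insertAfter-zipWith : (f : A → A → A) (j : ℕ) (a b : A) (u v : Vec A n) →
  insertAfter j (f a b) (zipWith f u v) ≡ zipWith f (insertAfter j a u) (insertAfter j b v)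
insertAfter-zipWith f zero    a b u       v       = refl
insertAfter-zipWith f (suc j) a b []      []      = refl
insertAfter-zipWith f (suc j) a b (x ∷ u) (y ∷ v) =
  cong (f x y ∷_) (insertAfter-zipWith f j a b u v)

supportFirst-zipWith : (f : A → A → A) (w : Word n) (u v : Vec A n) →
  supportFirst w (zipWith f u v) ≡ zipWith f (supportFirst w u) (supportFirst w v)
supportFirst-zipWith f []          []      []      = refl
supportFirst-zipWith f (true ∷ w)  (a ∷ u) (b ∷ v) =
  cong (f a b ∷_) (supportFirst-zipWith f w u v)
supportFirst-zipWith f (false ∷ w) (a ∷ u) (b ∷ v) =
  trans (cong (insertAfter (weight w) (f a b)) (supportFirst-zipWith f w u v))
        (insertAfter-zipWith f (weight w) a b (supportFirst w u) (supportFirst w v))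

insertAfter-replicate : ∀ j (a : A) → insertAfter j a (replicate n a) ≡ replicate (suc n) a
insertAfter-replicate {n = zero}  zero    a = refl
insertAfter-replicate {n = zero}  (suc j) a = refl
insertAfter-replicate {n = suc n} zero    a = refl
insertAfter-replicate {n = suc n} (suc j) a = cong (a ∷_) (insertAfter-replicate j a)

supportFirst-replicate : (w : Word n) (a : A) → supportFirst w (replicate n a) ≡ replicate n a
supportFirst-replicate []          a = refl
supportFirst-replicate (true ∷ w)  a = cong (a ∷_) (supportFirst-replicate w a)
supportFirst-replicate (false ∷ w) a =
  trans (cong (insertAfter (weight w) a) (supportFirst-replicate w a))
        (insertAfter-replicate (weight w) a)

weight-insertAfter : ∀ j a (v : Word n) → weight (insertAfter j a v) ≡ weight (a ∷ v)
weight-insertAfter zero    a     v           = refl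
weight-insertAfter (suc j) a     []          = refl
weight-insertAfter (suc j) true  (true ∷ v)  = cong suc (weight-insertAfter j true v)
weight-insertAfter (suc j) false (true ∷ v)  = cong suc (weight-insertAfter j false v)
weight-insertAfter (suc j) true  (false ∷ v) = weight-insertAfter j true v
weight-insertAfter (suc j) false (false ∷ v) = weight-insertAfter j false v

weight-supportFirst : (w v : Word n) → weight (supportFirst w v) ≡ weight v
weight-supportFirst []          []          = refl
weight-supportFirst (true ∷ w)  (true ∷ v)  = cong suc (weight-supportFirst w v)
weight-supportFirst (true ∷ w)  (false ∷ v) = weight-supportFirst w v
weight-supportFirst (false ∷ w) (true ∷ v)  =
  trans (weight-insertAfter (weight w) true _) (cong suc (weight-supportFirst w v))
weight-supportFirst (false ∷ w) (false ∷ v) =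
  trans (weight-insertAfter (weight w) false _) (weight-supportFirst w v)

isometry-supportFirst : (w : Word n) → IsIsometry (supportFirst w)
isometry-supportFirst w u v =
  trans (cong weight (sym (supportFirst-zipWith _xor_ w u v))) (weight-supportFirst w (u ⊕ v))

leadingOnes : ℕ → (n : ℕ) → Word n
leadingOnes zero    n       = replicate n false
leadingOnes (suc j) zero    = []
leadingOnes (suc j) (suc n) = true ∷ leadingOnes j n

uVec≡leadingOnes : ∀ k m → uVec k m ≡ leadingOnes k (k + m)
uVec≡leadingOnes zero    m = refl
uVec≡leadingOnes (suc k) m = cong (true ∷_) (uVec≡leadingOnes k m)

insertAfter-leadingOnes : ∀ j n → j ≤ n → insertAfter j false (leadingOnes j n) ≡ leadingOnes j (suc n)
insertAfter-leadingOnes zero    n       _         = refl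
insertAfter-leadingOnes (suc j) (suc n) (s≤s j≤n) = cong (true ∷_) (insertAfter-leadingOnes j n j≤n)

supportFirst-self : (w : Word n) → supportFirst w w ≡ leadingOnes (weight w) n
supportFirst-self []          = refl
supportFirst-self (true ∷ w)  = cong (true ∷_) (supportFirst-self w)
supportFirst-self {suc n} (false ∷ w) =
  trans (cong (insertAfter (weight w) false) (supportFirst-self w))
        (insertAfter-leadingOnes (weight w) n (weight≤length w))

standardise-pair : ∀ k m (p q : Word (k + m)) → dist p q ≡ k →
  ∃ λ (g : Word (k + m) → Word (k + m)) →
    IsIsometry g × g p ≡ replicate (k + m) false × g q ≡ uVec k m
standardise-pair k m p q pq≡k =
  supportFirst (p ⊕ q) ∘ (p ⊕_) ,
  isometry-∘ {g = supportFirst (p ⊕ q)} (isometry-supportFirst (p ⊕ q)) (isometry-translate p) ,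
  trans (cong (supportFirst (p ⊕ q)) (⊕-self p)) (supportFirst-replicate (p ⊕ q) false) ,
  (begin
    supportFirst (p ⊕ q) (p ⊕ q)   ≡⟨ supportFirst-self (p ⊕ q) ⟩
    leadingOnes (dist p q) (k + m) ≡⟨ cong (λ j → leadingOnes j (k + m)) pq≡k ⟩
    leadingOnes k (k + m)          ≡⟨ uVec≡leadingOnes k m ⟨
    uVec k m                       ∎)
  where open ≡-Reasoning

-- stepAway x y flips the first coordinate of y on which x and y agree (if there is one).
stepAway : Word n → Word n → Word n
stepAway []          []          = []
stepAway (true ∷ x)  (true ∷ y)  = false ∷ y
stepAway (false ∷ x) (false ∷ y) = true ∷ y
stepAway (true ∷ x)  (false ∷ y) = false ∷ stepAway x y
stepAway (false ∷ x) (true ∷ y)  = true ∷ stepAway x y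

dist-stepAway : (x y : Word n) → dist x y < n → dist x (stepAway x y) ≡ suc (dist x y)
dist-stepAway (true ∷ x)  (true ∷ y)  _         = refl
dist-stepAway (false ∷ x) (false ∷ y) _         = refl
dist-stepAway (true ∷ x)  (false ∷ y) (s≤s x<y) = cong suc (dist-stepAway x y x<y)
dist-stepAway (false ∷ x) (true ∷ y)  (s≤s x<y) = cong suc (dist-stepAway x y x<y)

dist-stepAway-self : (x y : Word n) → dist x y < n → dist (stepAway x y) y ≡ 1
dist-stepAway-self (true ∷ x)  (true ∷ y)  _         = cong suc (dist-self y)
dist-stepAway-self (false ∷ x) (false ∷ y) _         = cong suc (dist-self y)
dist-stepAway-self (true ∷ x)  (false ∷ y) (s≤s x<y) = dist-stepAway-self x y x<y
dist-stepAway-self (false ∷ x) (true ∷ y)  (s≤s x<y) = dist-stepAway-self x y x<y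

DiamAttained : ℕ → Subset n → Set
DiamAttained {n} k B = ∃ λ (p : Word n) → ∃ λ (q : Word n) → p ∈ B × q ∈ B × dist p q ≡ k

module _ {k : ℕ} {B : Subset n} (maximal : InB n k B) where

  diam≤ : DiamLe k B
  diam≤ = proj₁ maximal

  far-from-outsider : (w : Word n) → ¬ (w ∈ B) → ∃ λ b → b ∈ B × k < dist w b
  far-from-outsider w w∉B with proj₂ maximal w w∉B
  ... | a , b , a∈ , b∈ , k<ab with ≡-dec _≟B_ a w | ≡-dec _≟B_ b w
  ...   | yes refl | yes refl = ⊥-elim (n≮0 (subst (k <_) (dist-self a) k<ab))
  ...   | yes refl | no  _    = b , b∈ , k<ab
  ...   | no  _    | yes refl = a , a∈ , subst (k <_) (dist-sym a w) k<ab
  ...   | no  _    | no  _    = ⊥-elim (<⇒≱ k<ab (diam≤ a b a∈ b∈))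

  nonempty : ∃ λ b → b ∈ B
  nonempty with T? (B (replicate n false))
  ... | yes 0∈B = replicate n false , 0∈B
  ... | no  0∉B with far-from-outsider (replicate n false) 0∉B
  ...   | b , b∈B , _ = b , b∈B

  climb : k ≤ n → ∀ t {x y} → x ∈ B → y ∈ B → dist x y + t ≡ k → DiamAttained k B
  climb _   zero    {x} {y} x∈B y∈B xy≡k =
    x , y , x∈B , y∈B , trans (sym (+-identityʳ (dist x y))) xy≡k
  climb k≤n (suc t) {x} {y} x∈B y∈B xy+t≡k = step (T? (B (stepAway x y)))
    where
    xy<n : dist x y < n
    xy<n = <-≤-trans (subst (dist x y <_) xy+t≡k (m<m+n (dist x y) (s≤s z≤n))) k≤n

    step : Dec (stepAway x y ∈ B) → DiamAttained k B
    step (yes y′∈B) = climb k≤n t x∈B y′∈B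
      (trans (cong (_+ t) (dist-stepAway x y xy<n)) (trans (sym (+-suc (dist x y) t)) xy+t≡k))
    step (no y′∉B) with far-from-outsider (stepAway x y) y′∉B
    ... | b , b∈B , k<y′b = y , b , y∈B , b∈B , ≤-antisym (diam≤ y b y∈B b∈B)
            (dist≥-neighbour (stepAway x y) y b (dist-stepAway-self x y xy<n) k<y′b)

  diam-attained : k ≤ n → DiamAttained k B
  diam-attained k≤n with nonempty
  ... | b , b∈B = climb k≤n k b∈B b∈B (cong (_+ k) (dist-self b))

proposition4 : (k m : ℕ) → 1 ≤ k → (B : Subset (k + m)) → InB (k + m) k B →
    ∃ λ (g : Word (k + m) → Word (k + m)) →
      IsIsometry g × (∀ v → v ∈ B → T₂ k m (g v))
proposition4 k m _ B maximal with diam-attained maximal (m≤m+n k m)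
... | p , q , p∈B , q∈B , pq≡k with standardise-pair k m p q pq≡k
...   | g , g-iso , gp≡0 , gq≡u = g , g-iso , λ v v∈B →
        within gp≡0 (diam≤ maximal v p v∈B p∈B) , within gq≡u (diam≤ maximal v q v∈B q∈B)
  where
  within : ∀ {v c c′} → g c ≡ c′ → dist v c ≤ k → dist (g v) c′ ≤ k
  within {v} {c} refl vc≤k = subst (_≤ k) (sym (g-iso v c)) vc≤k
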